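{- Let $a_0\in\{1,-1\}$, let $a_1,a_3,a_5,\dots$ (all odd-indexed $a_{2m+1}$, $m\ge 0$) be arbitrary real numbers, and let $b_i=(-1)^i a_0$ for $i\ge 0$ (so $b_{2m}=a_0$ and $b_{2m+1}=-b_{2m}$). Let $t(i,j)$ be the zero-sum triangle (defined in the context) with left boundary $(a_i)$ and right boundary $(b_i)$, where the even-indexed left boundary values $a_{2m}$, $m\ge1$, are determined recursively by $$a_{2m}=-\frac{a_0}{2}\sum_{k=1}^{2m-1}t(2m,k)a_k$$ (the right-hand side depends only on $a_1,\dots,a_{2m-1}$ and $b_0,\dots,b_{2m}$). For $n\ge 1$ let $T_n$ be the $n\times n$ lower triangular matrix with $T_n(i+1,j+1)=t(i,j)$ for $0\le j\le i\le n-1$ and zeros above the diagonal. Then $T_n^2=I$ for every $n\ge1$. Moreover, with $s_0(i)=\sum_{k=0}^{i}t(i,k)a_k$, $s_1(i)=\sum_{k=0}^{i}t(i,k)a_{k+1}$, $s_{ -1}(i)=\sum_{k=1}^{i}t(i,k)a_{k-1}$, one has $s_0(0)=1$, $s_1(0)=a_0a_1$, $s_{ -1}(1)=-1$, and for all $i\ge1$: $$s_0(i)=0,\qquad s_1(i)=a_0\{a_i+a_{i+1}\},\qquad s_{ -1}(i)=(-1)^i.$$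
   Context: Zero-sum triangle: given sequences $(a_i)_{i\ge0}$, $(b_i)_{i\ge0}$ with $b_0=a_0$, define numbers $t(i,j)$ for integers $0\le j\le i$ by $t(i,0)=a_i$ for $i\ge 0$, $t(i,i)=b_i$ for $i\ge 1$, and for $0<j<i$ by the zero-sum rule $t(i,j)+t(i-1,j-1)+t(i-1,j)=0$, i.e. $t(i,j)=-t(i-1,j-1)-t(i-1,j)$. -}

module Defs where

open import Level using (Level)
open import Algebra.Bundles using (CommutativeRing)
open import Data.Nat using (ℕ; zero; suc; _≤?_; _≟_)
open import Relation.Nullary using (yes; no)

module _ {c ℓ : Level} (R : CommutativeRing c ℓ) where
  open CommutativeRing R

  ∑ : ℕ → (ℕ → Carrier) → Carrier
  ∑ zero    f = 0#
  ∑ (suc n) f = ∑ n f + f n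

  alt : ℕ → Carrier
  alt zero    = 1#
  alt (suc i) = - alt i

  lowerTri : (ℕ → ℕ → Carrier) → ℕ → ℕ → Carrier
  lowerTri t i j with j ≤? i
  ... | yes _ = t i j
  ... | no  _ = 0#

  δ : ℕ → ℕ → Carrier
  δ i j with i ≟ j
  ... | yes _ = 1#
  ... | no  _ = 0#

-- Extended by zeros above the diagonal, the triangle obeys the zero-sum rule everywhere, so
-- that it can be read along rows and along columns alike; this makes (T²)(i+1, j+1) = (T²)(i, j),
-- and T² = I reduces to its first column, which is s₀ = T a.  For odd n, computing (T s₀)(n)
-- once directly and once as (T² a)(n) gives 2 a₀ s₀(n) = 0 as soon as s₀ vanishes below n; for
-- even n the choice of a_n is exactly what makes s₀(n) vanish.  The formulas for s₁ and s₋₁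
-- are the zero-sum rule applied to the sums defining s₀.

module Submission where

open import Defs
open import Level using (Level)
open import Algebra.Bundles using (CommutativeRing)
open import Data.Nat using (ℕ; zero; suc; _*_; _<_; _≤_)
open import Data.Sum using (_⊎_)
open import Data.Product using (_×_)

open import Data.Nat using (_∸_; _≤′_; ≤′-refl; ≤′-step; z≤n; s≤s; _≤?_; _≟_)
open import Data.Nat.Properties
  using (≤-refl; ≤-pred; <⇒≤; <⇒≱; ≤-<-trans; ≰⇒>; <-cmp; n≤1+n; m<n⇒m<1+n; m≤n⇒m≤1+n;
         ≤⇒≤′; ≤′⇒≤; *-suc; n∸n≡0; m∸n≤m; m<n⇒0<n∸m)
open import Data.Nat.Induction using (<-rec)
open import Data.Product using (_,_; ∃)
open import Data.Sum using (inj₁; inj₂)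
open import Function using (_∘_)
open import Relation.Nullary using (yes; no)
open import Relation.Nullary.Negation using (contradiction)
open import Relation.Binary.Definitions using (tri<; tri≈; tri>)
open import Relation.Binary.PropositionalEquality as ≡ using (_≡_; _≢_)
import Algebra.Properties.Ring as RingProperties
import Algebra.Properties.CommutativeSemigroup as CommutativeSemigroupProperties
import Relation.Binary.Reasoning.Setoid as SetoidReasoning

even-or-odd : ∀ n → (∃ λ m → n ≡ 2 * m) ⊎ (∃ λ m → n ≡ suc (2 * m))
even-or-odd zero = inj₁ (0 , ≡.refl)
even-or-odd (suc n) with even-or-odd n
... | inj₁ (m , ≡.refl) = inj₂ (m , ≡.refl)
... | inj₂ (m , ≡.refl) = inj₁ (suc m , ≡.sym (*-suc 2 m))

module _ {r ℓ : Level} (R : CommutativeRing r ℓ) where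
  open CommutativeRing R renaming (_*_ to _·_)
  open RingProperties ring
    using (-1*x≈-x; -‿distribˡ-*; -‿distribʳ-*; -‿involutive; -‿+-comm; +-cancelʳ; +-inverseˡ-unique)
  open CommutativeSemigroupProperties +-commutativeSemigroup
    using (interchange; xy∙z≈xz∙y; x∙yz≈zy∙x)
  open SetoidReasoning setoid

  ∑-cong : ∀ n {f g : ℕ → Carrier} → (∀ {k} → k < n → f k ≈ g k) → ∑ R n f ≈ ∑ R n g
  ∑-cong zero    _   = refl
  ∑-cong (suc n) f≈g = +-cong (∑-cong n (f≈g ∘ m<n⇒m<1+n)) (f≈g ≤-refl)

  ∑-zero : ∀ n {f : ℕ → Carrier} → (∀ {k} → k < n → f k ≈ 0#) → ∑ R n f ≈ 0#
  ∑-zero zero    _   = refl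
  ∑-zero (suc n) f≈0 = trans (+-cong (∑-zero n (f≈0 ∘ m<n⇒m<1+n)) (f≈0 ≤-refl)) (+-identityʳ 0#)

  ∑-suc : ∀ n f → ∑ R (suc n) f ≈ f 0 + ∑ R n (f ∘ suc)
  ∑-suc zero    f = trans (+-identityˡ _) (sym (+-identityʳ _))
  ∑-suc (suc n) f = trans (+-congʳ (∑-suc n f)) (+-assoc _ _ _)

  ∑-+ : ∀ n f g → ∑ R n (λ k → f k + g k) ≈ ∑ R n f + ∑ R n g
  ∑-+ zero    f g = sym (+-identityʳ 0#)
  ∑-+ (suc n) f g = trans (+-congʳ (∑-+ n f g)) (interchange _ _ _ _)

  ∑-*ˡ : ∀ n x f → ∑ R n (λ k → x · f k) ≈ x · ∑ R n f
  ∑-*ˡ zero    x f = sym (zeroʳ x)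
  ∑-*ˡ (suc n) x f = trans (+-congʳ (∑-*ˡ n x f)) (sym (distribˡ x _ _))

  ∑-*ʳ : ∀ n x f → ∑ R n (λ k → f k · x) ≈ ∑ R n f · x
  ∑-*ʳ zero    x f = sym (zeroˡ x)
  ∑-*ʳ (suc n) x f = trans (+-congʳ (∑-*ʳ n x f)) (sym (distribʳ x _ _))

  ∑-swap : ∀ n m (F : ℕ → ℕ → Carrier) →
           ∑ R n (λ i → ∑ R m (F i)) ≈ ∑ R m (λ j → ∑ R n (λ i → F i j))
  ∑-swap zero    m F = sym (∑-zero m (λ _ → refl))
  ∑-swap (suc n) m F = trans (+-congʳ (∑-swap n m F)) (sym (∑-+ m _ (F n)))

  ∑-truncate : ∀ {m n f} → m ≤ n → (∀ {k} → m ≤ k → f k ≈ 0#) → ∑ R n f ≈ ∑ R m f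
  ∑-truncate {m} {f = f} m≤n f≈0 = go (≤⇒≤′ m≤n)
    where
    go : ∀ {n} → m ≤′ n → ∑ R n f ≈ ∑ R m f
    go ≤′-refl        = refl
    go (≤′-step m≤′n) = trans (+-cong (go m≤′n) (f≈0 (≤′⇒≤ m≤′n))) (+-identityʳ _)

  ∑-endpoints : ∀ n {f} → (∀ {k} → k < n → f (suc k) ≈ 0#) → ∑ R (suc (suc n)) f ≈ f 0 + f (suc n)
  ∑-endpoints n {f} inner≈0 =
    +-congʳ (trans (∑-suc n f) (trans (+-congˡ (∑-zero n inner≈0)) (+-identityʳ _)))

  δ-refl : ∀ i → δ R i i ≈ 1#
  δ-refl i with i ≟ i
  ... | yes _  = refl
  ... | no i≢i = contradiction ≡.refl i≢i

  δ-≢ : ∀ {i j} → i ≢ j → δ R i j ≈ 0#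
  δ-≢ {i} {j} i≢j with i ≟ j
  ... | yes i≡j = contradiction i≡j i≢j
  ... | no _    = refl

  sign-squared : ∀ {x} → x ≈ 1# ⊎ x ≈ - 1# → x · x ≈ 1#
  sign-squared (inj₁ x≈1)  = trans (*-cong x≈1 x≈1) (*-identityˡ 1#)
  sign-squared (inj₂ x≈-1) = begin
    _ · _        ≈⟨ *-cong x≈-1 x≈-1 ⟩
    - 1# · - 1#  ≈⟨ -‿distribˡ-* 1# (- 1#) ⟨
    - (1# · - 1#) ≈⟨ trans (-‿cong (*-identityˡ (- 1#))) (-‿involutive 1#) ⟩
    1# ∎

  module LowerTriangularZeroSum
    (L : ℕ → ℕ → Carrier)
    (L-upper : ∀ {i k} → i < k → L i k ≈ 0#)
    (L-zero-sum : ∀ i j → L (suc i) (suc j) + L i (suc j) + L i j ≈ 0#)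
    where

    apply : (ℕ → Carrier) → ℕ → Carrier
    apply h i = ∑ R (suc i) (λ k → L i k · h k)

    column : ℕ → ℕ → Carrier
    column j k = L k j

    ∑-row : ∀ {N i} h → i < N → ∑ R N (λ k → L i k · h k) ≈ apply h i
    ∑-row h i<N = ∑-truncate i<N (λ i<k → trans (*-congʳ (L-upper i<k)) (zeroˡ _))

    apply-+ : ∀ f g i → apply (λ k → f k + g k) i ≈ apply f i + apply g i
    apply-+ f g i = trans (∑-cong (suc i) (λ _ → distribˡ _ _ _)) (∑-+ (suc i) _ _)

    ∑-zero-sum : ∀ N i (h : ℕ → Carrier) →
      ∑ R N (λ k → L (suc i) (suc k) · h k) + ∑ R N (λ k → L i (suc k) · h k)
        + ∑ R N (λ k → L i k · h k) ≈ 0#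
    ∑-zero-sum N i h = begin
      ∑ R N A + ∑ R N B + ∑ R N C                   ≈⟨ +-congʳ (∑-+ N A B) ⟨
      ∑ R N (λ k → A k + B k) + ∑ R N C             ≈⟨ ∑-+ N (λ k → A k + B k) C ⟨
      ∑ R N (λ k → A k + B k + C k)                 ≈⟨ ∑-zero N (λ {k} _ → pointwise k) ⟩
      0# ∎
      where
      A B C : ℕ → Carrier
      A k = L (suc i) (suc k) · h k
      B k = L i (suc k) · h k
      C k = L i k · h k
      pointwise : ∀ k → A k + B k + C k ≈ 0#
      pointwise k = trans (sym (trans (distribʳ _ _ _) (+-congʳ (distribʳ _ _ _))))
                          (trans (*-congʳ (L-zero-sum i k)) (zeroˡ _))

    apply-shift : ∀ h i →
      apply h (suc i) + apply h i + apply (h ∘ suc) i ≈ (L (suc i) 0 + L i 0) · h 0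
    apply-shift h i = begin
      apply h (suc i) + apply h i + apply (h ∘ suc) i
        ≈⟨ +-congʳ (+-cong (∑-suc (suc i) _) (trans (sym (∑-row h (n≤1+n (suc i)))) (∑-suc (suc i) _))) ⟩
      (L (suc i) 0 · h 0 + P) + (L i 0 · h 0 + Q) + apply (h ∘ suc) i
        ≈⟨ trans (+-congʳ (interchange _ _ _ _)) (+-assoc _ _ _) ⟩
      (L (suc i) 0 · h 0 + L i 0 · h 0) + (P + Q + apply (h ∘ suc) i)
        ≈⟨ +-congˡ (∑-zero-sum (suc i) i (h ∘ suc)) ⟩
      (L (suc i) 0 · h 0 + L i 0 · h 0) + 0#
        ≈⟨ trans (+-identityʳ _) (sym (distribʳ _ _ _)) ⟩
      (L (suc i) 0 + L i 0) · h 0 ∎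
      where
      P Q : Carrier
      P = ∑ R (suc i) (λ k → L (suc i) (suc k) · h (suc k))
      Q = ∑ R (suc i) (λ k → L i (suc k) · h (suc k))

    -- Both sides are cancelled by the same sum: the first via apply-shift (the top entry
    -- of column suc l is zero), the second via the zero-sum rule read along columns.
    apply-column-suc : ∀ l i → apply (column (suc l)) (suc i) ≈ apply (column l) i
    apply-column-suc l i =
      trans (+-inverseˡ-unique _ _ by-rows) (sym (+-inverseˡ-unique _ _ by-columns))
      where
      c : ℕ → Carrier
      c = column (suc l)
      by-rows : apply c (suc i) + (apply c i + apply (c ∘ suc) i) ≈ 0#
      by-rows = trans (sym (+-assoc _ _ _)) (trans (apply-shift c i)
                  (trans (*-congˡ (L-upper (s≤s z≤n))) (zeroʳ _)))
      by-columns : apply (column l) i + (apply c i + apply (c ∘ suc) i) ≈ 0#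
      by-columns = begin
        apply (column l) i + (apply c i + apply (c ∘ suc) i)
          ≈⟨ +-congˡ (apply-+ c (c ∘ suc) i) ⟨
        apply (column l) i + apply (λ k → c k + c (suc k)) i
          ≈⟨ apply-+ (column l) _ i ⟨
        apply (λ k → L k l + (L k (suc l) + L (suc k) (suc l))) i
          ≈⟨ ∑-zero (suc i) (λ {k} _ →
               trans (*-congˡ (trans (x∙yz≈zy∙x _ _ _) (L-zero-sum k l))) (zeroʳ _)) ⟩
        0# ∎

    apply-column : ∀ {l i} → l ≤ i → apply (column l) i ≈ apply (column 0) (i ∸ l)
    apply-column z≤n = refl
    apply-column {suc l} {suc i} (s≤s l≤i) = trans (apply-column-suc l i) (apply-column l≤i)

    apply-apply : ∀ h n → apply (apply h) n ≈ ∑ R (suc n) (λ l → apply (column l) n · h l)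
    apply-apply h n = begin
      ∑ R (suc n) (λ k → L n k · apply h k)
        ≈⟨ ∑-cong (suc n) (λ k<n → *-congˡ (sym (∑-row h k<n))) ⟩
      ∑ R (suc n) (λ k → L n k · ∑ R (suc n) (λ l → L k l · h l))
        ≈⟨ ∑-cong (suc n) (λ {k} _ → sym (∑-*ˡ (suc n) (L n k) _)) ⟩
      ∑ R (suc n) (λ k → ∑ R (suc n) (λ l → L n k · (L k l · h l)))
        ≈⟨ ∑-swap (suc n) (suc n) _ ⟩
      ∑ R (suc n) (λ l → ∑ R (suc n) (λ k → L n k · (L k l · h l)))
        ≈⟨ ∑-cong (suc n) (λ {l} _ → trans (∑-cong (suc n) (λ _ → sym (*-assoc _ _ _)))
                                           (∑-*ʳ (suc n) (h l) _)) ⟩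
      ∑ R (suc n) (λ l → apply (column l) n · h l) ∎

    square-upper : ∀ N {i j} → i < j → ∑ R N (λ k → L i k · L k j) ≈ 0#
    square-upper N {i} {j} i<j = ∑-zero N (λ {k} _ → term k)
      where
      term : ∀ k → L i k · L k j ≈ 0#
      term k with k ≤? i
      ... | yes k≤i = trans (*-congˡ (L-upper (≤-<-trans k≤i i<j))) (zeroʳ _)
      ... | no  k≰i = trans (*-congʳ (L-upper (≰⇒> k≰i))) (zeroˡ _)

  lowerTri-lower : ∀ t {i k} → k ≤ i → lowerTri R t i k ≈ t i k
  lowerTri-lower t {i} {k} k≤i with k ≤? i
  ... | yes _   = refl
  ... | no  k≰i = contradiction k≤i k≰i

  lowerTri-upper : ∀ t {i k} → i < k → lowerTri R t i k ≈ 0#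
  lowerTri-upper t {i} {k} i<k with k ≤? i
  ... | yes k≤i = contradiction k≤i (<⇒≱ i<k)
  ... | no  _   = refl

  -- On the diagonal the rule holds because consecutive diagonal entries have opposite signs.
  lowerTri-zero-sum : ∀ t x →
    (∀ i → t i i ≈ alt R i · x) →
    (∀ i j → j < i → t (suc i) (suc j) + t i j + t i (suc j) ≈ 0#) →
    ∀ i j → let L = lowerTri R t in L (suc i) (suc j) + L i (suc j) + L i j ≈ 0#
  lowerTri-zero-sum t x t-diagonal t-zero-sum i j with <-cmp j i
  ... | tri< j<i _ _ = begin
    lowerTri R t (suc i) (suc j) + lowerTri R t i (suc j) + lowerTri R t i j
      ≈⟨ +-cong (+-cong (lowerTri-lower t (s≤s (<⇒≤ j<i))) (lowerTri-lower t j<i))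
                (lowerTri-lower t (<⇒≤ j<i)) ⟩
    t (suc i) (suc j) + t i (suc j) + t i j  ≈⟨ xy∙z≈xz∙y _ _ _ ⟩
    t (suc i) (suc j) + t i j + t i (suc j)  ≈⟨ t-zero-sum i j j<i ⟩
    0# ∎
  ... | tri≈ _ ≡.refl _ = begin
    lowerTri R t (suc i) (suc i) + lowerTri R t i (suc i) + lowerTri R t i i
      ≈⟨ +-cong (+-cong (lowerTri-lower t ≤-refl) (lowerTri-upper t {i} ≤-refl))
                (lowerTri-lower t ≤-refl) ⟩
    t (suc i) (suc i) + 0# + t i i
      ≈⟨ +-cong (trans (+-identityʳ _) (t-diagonal (suc i))) (t-diagonal i) ⟩
    - alt R i · x + alt R i · x   ≈⟨ +-congʳ (-‿distribˡ-* _ _) ⟨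
    - (alt R i · x) + alt R i · x ≈⟨ -‿inverseˡ _ ⟩
    0# ∎
  ... | tri> _ _ i<j =
    trans (+-cong (+-cong (lowerTri-upper t (s≤s i<j)) (lowerTri-upper t (m<n⇒m<1+n i<j)))
                  (lowerTri-upper t i<j))
          (trans (+-identityʳ _) (+-identityʳ _))

  module ZeroSumTriangle
    (half : Carrier) (half+half≈1 : half + half ≈ 1#)
    (a : ℕ → Carrier) (t : ℕ → ℕ → Carrier)
    (a₀-sign : a 0 ≈ 1# ⊎ a 0 ≈ - 1#)
    (t-left : ∀ i → t i 0 ≈ a i)
    (t-right : ∀ i → 1 ≤ i → t i i ≈ alt R i · a 0)
    (t-zero-sum : ∀ i j → j < i → t (suc i) (suc j) + t i j + t i (suc j) ≈ 0#)
    (a-even : ∀ m → a (2 * suc m) ≈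
                - (a 0 · half) · ∑ R (suc (2 * m)) (λ k → t (2 * suc m) (suc k) · a (suc k)))
    where

    a₀² : a 0 · a 0 ≈ 1#
    a₀² = sign-squared a₀-sign

    a₀-cancel : ∀ {x} → a 0 · x ≈ 0# → x ≈ 0#
    a₀-cancel {x} a₀x≈0 = begin
      x               ≈⟨ trans (*-congʳ a₀²) (*-identityˡ x) ⟨
      a 0 · a 0 · x   ≈⟨ *-assoc _ _ _ ⟩
      a 0 · (a 0 · x) ≈⟨ trans (*-congˡ a₀x≈0) (zeroʳ _) ⟩
      0# ∎

    double-cancel : ∀ {x} → x + x ≈ 0# → x ≈ 0#
    double-cancel {x} x+x≈0 = begin
      x                 ≈⟨ trans (*-congʳ half+half≈1) (*-identityˡ x) ⟨
      (half + half) · x ≈⟨ trans (distribʳ _ _ _) (sym (distribˡ _ _ _)) ⟩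
      half · (x + x)    ≈⟨ trans (*-congˡ x+x≈0) (zeroʳ _) ⟩
      0# ∎

    alt-even : ∀ m → alt R (2 * m) ≈ 1#
    alt-even zero    = refl
    alt-even (suc m) =
      trans (reflexive (≡.cong (alt R) (*-suc 2 m))) (trans (-‿involutive _) (alt-even m))

    alt-odd : ∀ m → alt R (suc (2 * m)) ≈ - 1#
    alt-odd m = -‿cong (alt-even m)

    t-diagonal : ∀ i → t i i ≈ alt R i · a 0
    t-diagonal zero    = trans (t-left 0) (sym (*-identityˡ _))
    t-diagonal (suc i) = t-right (suc i) (s≤s z≤n)

    L : ℕ → ℕ → Carrier
    L = lowerTri R t

    open LowerTriangularZeroSum L (lowerTri-upper t) (lowerTri-zero-sum t (a 0) t-diagonal t-zero-sum)

    L-left : ∀ i → L i 0 ≈ a i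
    L-left i = trans (lowerTri-lower t z≤n) (t-left i)

    L-diagonal : ∀ i → L i i ≈ alt R i · a 0
    L-diagonal i = trans (lowerTri-lower t ≤-refl) (t-diagonal i)

    t-row : ∀ i h → ∑ R (suc i) (λ k → t i k · h k) ≈ apply h i
    t-row i h = ∑-cong (suc i) (λ k<1+i → *-congʳ (sym (lowerTri-lower t (≤-pred k<1+i))))

    s₀ : ℕ → Carrier
    s₀ = apply a

    s₀-zero : s₀ 0 ≈ 1#
    s₀-zero = trans (+-identityˡ _) (trans (*-congʳ (L-left 0)) a₀²)

    square-column : ∀ {l i} → l ≤ i → apply (column l) i ≈ s₀ (i ∸ l)
    square-column {l} {i} l≤i =
      trans (apply-column l≤i) (∑-cong (suc (i ∸ l)) (λ {k} _ → *-congˡ (L-left k)))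

    square-diagonal : ∀ i → apply (column i) i ≈ 1#
    square-diagonal i =
      trans (square-column {i} ≤-refl) (trans (reflexive (≡.cong s₀ (n∸n≡0 i))) s₀-zero)

    -- a_n is chosen so that the two boundary terms a_n a₀ and a₀ a_n cancel the inner sum.
    s₀-even : ∀ m → s₀ (suc (suc (2 * m))) ≈ 0#
    s₀-even m = begin
      s₀ n                                ≈⟨ +-congʳ (∑-suc (suc M) _) ⟩
      L n 0 · a 0 + inner-L + L n n · a n ≈⟨ +-cong (+-cong (*-congʳ (L-left n)) inner-t) diagonal ⟩
      a n · a 0 + inner + a 0 · a n       ≈⟨ xy∙z≈xz∙y _ _ _ ⟩
      a n · a 0 + a 0 · a n + inner       ≈⟨ +-congʳ (+-cong (trans (*-comm _ _) a₀aₙ) a₀aₙ) ⟩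
      - (half · inner) + - (half · inner) + inner
        ≈⟨ +-congʳ (trans (-‿+-comm _ _) (-‿cong (trans (sym (distribʳ _ _ _))
                                          (trans (*-congʳ half+half≈1) (*-identityˡ _))))) ⟩
      - inner + inner                     ≈⟨ -‿inverseˡ inner ⟩
      0# ∎
      where
      M n : ℕ
      M = 2 * m
      n = suc (suc M)
      inner-L inner : Carrier
      inner-L = ∑ R (suc M) (λ k → L n (suc k) · a (suc k))
      inner   = ∑ R (suc M) (λ k → t n (suc k) · a (suc k))
      inner-t : inner-L ≈ inner
      inner-t = ∑-cong (suc M) (λ k<1+M → *-congʳ (lowerTri-lower t (m≤n⇒m≤1+n k<1+M)))
      diagonal : L n n · a n ≈ a 0 · a n
      diagonal = *-congʳ (trans (L-diagonal n)
                   (trans (*-congʳ (trans (-‿involutive _) (alt-even m))) (*-identityˡ _)))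
      a-even′ : a n ≈ - (a 0 · half) · inner
      a-even′ = ≡.subst (λ E → a E ≈ - (a 0 · half) · ∑ R (suc M) (λ k → t E (suc k) · a (suc k)))
                        (*-suc 2 m) (a-even m)
      a₀aₙ : a 0 · a n ≈ - (half · inner)
      a₀aₙ = begin
        a 0 · a n                        ≈⟨ *-congˡ a-even′ ⟩
        a 0 · (- (a 0 · half) · inner)   ≈⟨ *-congˡ (-‿distribˡ-* _ _) ⟨
        a 0 · - (a 0 · half · inner)     ≈⟨ -‿distribʳ-* _ _ ⟨
        - (a 0 · (a 0 · half · inner))   ≈⟨ -‿cong (sym (trans (*-congʳ (*-assoc _ _ _)) (*-assoc _ _ _))) ⟩
        - (a 0 · a 0 · half · inner)     ≈⟨ -‿cong (*-congʳ (trans (*-congʳ a₀²) (*-identityˡ _))) ⟩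
        - (half · inner) ∎

    -- Evaluate (T s₀)(n) once using the vanishing of s₀ below n, once as (T² a)(n) = Σ_l s₀(n − l) a_l.
    s₀-odd : ∀ m → (∀ {k} → 1 ≤ k → k < suc (2 * m) → s₀ k ≈ 0#) → s₀ (suc (2 * m)) ≈ 0#
    s₀-odd m s₀-below≈0 = a₀-cancel (double-cancel (begin
      w + w   ≈⟨ +-congˡ (+-cancelʳ (a n) _ _ -w+aₙ≈w+aₙ) ⟨
      w + - w ≈⟨ -‿inverseʳ w ⟩
      0# ∎))
      where
      M n : ℕ
      M = 2 * m
      n = suc M
      w : Carrier
      w = a 0 · s₀ n
      by-vanishing : apply s₀ n ≈ a n + - a 0 · s₀ n
      by-vanishing = begin
        apply s₀ n
          ≈⟨ ∑-endpoints M (λ k<M → trans (*-congˡ (s₀-below≈0 (s≤s z≤n) (s≤s k<M))) (zeroʳ _)) ⟩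
        L n 0 · s₀ 0 + L n n · s₀ n
          ≈⟨ +-cong (trans (*-cong (L-left n) s₀-zero) (*-identityʳ _))
                    (*-congʳ (trans (L-diagonal n) (trans (*-congʳ (alt-odd m)) (-1*x≈-x _)))) ⟩
        a n + - a 0 · s₀ n ∎
      inner-columns-vanish : ∀ {k} → k < M → apply (column (suc k)) n ≈ 0#
      inner-columns-vanish {k} k<M =
        trans (square-column (m≤n⇒m≤1+n k<M)) (s₀-below≈0 (m<n⇒0<n∸m k<M) (s≤s (m∸n≤m M k)))
      by-square : apply s₀ n ≈ s₀ n · a 0 + a n
      by-square = begin
        apply s₀ n
          ≈⟨ apply-apply a n ⟩
        ∑ R (suc n) (λ l → apply (column l) n · a l)
          ≈⟨ ∑-endpoints M (λ k<M → trans (*-congʳ (inner-columns-vanish k<M)) (zeroˡ _)) ⟩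
        apply (column 0) n · a 0 + apply (column n) n · a n
          ≈⟨ +-cong (*-congʳ (square-column z≤n))
                    (trans (*-congʳ (square-diagonal n)) (*-identityˡ _)) ⟩
        s₀ n · a 0 + a n ∎
      -w+aₙ≈w+aₙ : - w + a n ≈ w + a n
      -w+aₙ≈w+aₙ = begin
        - w + a n           ≈⟨ trans (+-comm _ _) (+-congˡ (-‿distribˡ-* _ _)) ⟩
        a n + - a 0 · s₀ n  ≈⟨ by-vanishing ⟨
        apply s₀ n          ≈⟨ by-square ⟩
        s₀ n · a 0 + a n    ≈⟨ +-congʳ (*-comm _ _) ⟩
        w + a n ∎

    s₀-vanishes : ∀ {n} → 1 ≤ n → s₀ n ≈ 0#
    s₀-vanishes {n} = <-rec (λ n → 1 ≤ n → s₀ n ≈ 0#) step n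
      where
      step : ∀ n → (∀ {k} → k < n → 1 ≤ k → s₀ k ≈ 0#) → 1 ≤ n → s₀ n ≈ 0#
      step (suc n) below _ with even-or-odd n
      ... | inj₁ (m , ≡.refl) = s₀-odd m (λ 1≤k k<n → below k<n 1≤k)
      ... | inj₂ (m , ≡.refl) = s₀-even m

    square≈δ : ∀ {N i j} → i < N → j < N → ∑ R N (λ k → L i k · L k j) ≈ δ R i j
    square≈δ {N} {i} {j} i<N _ with <-cmp i j
    ... | tri< i<j i≢j _ = trans (square-upper N i<j) (sym (δ-≢ i≢j))
    ... | tri≈ _ ≡.refl _ = begin
      ∑ R N (λ k → L i k · L k i) ≈⟨ trans (∑-row (column i) i<N) (square-diagonal i) ⟩
      1#                          ≈⟨ δ-refl i ⟨
      δ R i i ∎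
    ... | tri> _ i≢j j<i = begin
      ∑ R N (λ k → L i k · L k j) ≈⟨ trans (∑-row (column j) i<N) (square-column (<⇒≤ j<i)) ⟩
      s₀ (i ∸ j)                  ≈⟨ s₀-vanishes (m<n⇒0<n∸m j<i) ⟩
      0#                          ≈⟨ δ-≢ i≢j ⟨
      δ R i j ∎

    s₁-formula : ∀ {i} → 1 ≤ i → ∑ R (suc i) (λ k → t i k · a (suc k)) ≈ a 0 · (a i + a (suc i))
    s₁-formula {i} 1≤i = begin
      ∑ R (suc i) (λ k → t i k · a (suc k))      ≈⟨ t-row i (a ∘ suc) ⟩
      apply (a ∘ suc) i                          ≈⟨ trans (+-congʳ (+-identityʳ 0#)) (+-identityˡ _) ⟨
      0# + 0# + apply (a ∘ suc) i                ≈⟨ +-congʳ (+-cong (s₀-vanishes (s≤s z≤n)) (s₀-vanishes 1≤i)) ⟨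
      s₀ (suc i) + s₀ i + apply (a ∘ suc) i      ≈⟨ apply-shift a i ⟩
      (L (suc i) 0 + L i 0) · a 0                ≈⟨ *-congʳ (+-cong (L-left (suc i)) (L-left i)) ⟩
      (a (suc i) + a i) · a 0                    ≈⟨ trans (*-comm _ _) (*-congˡ (+-comm _ _)) ⟩
      a 0 · (a i + a (suc i)) ∎

    s₋₁ : ℕ → Carrier
    s₋₁ i = ∑ R i (λ k → L i (suc k) · a k)

    s₋₁-alternates : ∀ {i} → 1 ≤ i → s₋₁ (suc i) ≈ - s₋₁ i
    s₋₁-alternates {i} 1≤i = +-inverseˡ-unique _ _ (begin
      s₋₁ (suc i) + s₋₁ i
        ≈⟨ +-congˡ (trans (+-congˡ (trans (*-congʳ (lowerTri-upper t {i} ≤-refl)) (zeroˡ _))) (+-identityʳ _)) ⟨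
      s₋₁ (suc i) + ∑ R (suc i) (λ k → L i (suc k) · a k)
        ≈⟨ trans (+-congˡ (s₀-vanishes 1≤i)) (+-identityʳ _) ⟨
      s₋₁ (suc i) + ∑ R (suc i) (λ k → L i (suc k) · a k) + s₀ i
        ≈⟨ ∑-zero-sum (suc i) i a ⟩
      0# ∎)

    s₋₁≈alt : ∀ {i} → 1 ≤ i → s₋₁ i ≈ alt R i
    s₋₁≈alt {suc zero} _ = begin
      0# + L 1 1 · a 0  ≈⟨ +-identityˡ _ ⟩
      L 1 1 · a 0       ≈⟨ *-congʳ (L-diagonal 1) ⟩
      - 1# · a 0 · a 0  ≈⟨ trans (*-assoc _ _ _) (trans (*-congˡ a₀²) (*-identityʳ _)) ⟩
      - 1# ∎
    s₋₁≈alt {suc (suc i)} _ = trans (s₋₁-alternates (s≤s z≤n)) (-‿cong (s₋₁≈alt (s≤s z≤n)))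

    s₋₁-formula : ∀ {i} → 1 ≤ i → ∑ R i (λ k → t i (suc k) · a k) ≈ alt R i
    s₋₁-formula {i} 1≤i =
      trans (∑-cong i (λ k<i → *-congʳ (sym (lowerTri-lower t k<i)))) (s₋₁≈alt 1≤i)

theorem2 : ∀ {c ℓ : Level} (R : CommutativeRing c ℓ) →
    let open CommutativeRing R renaming (_*_ to _·_) in
    (half : Carrier) → half + half ≈ 1# →
    (a : ℕ → Carrier) (t : ℕ → ℕ → Carrier) →
    (a 0 ≈ 1# ⊎ a 0 ≈ - 1#) →
    (∀ i → t i 0 ≈ a i) →
    (∀ i → 1 ≤ i → t i i ≈ alt R i · a 0) →
    (∀ i j → j < i → t (suc i) (suc j) + t i j + t i (suc j) ≈ 0#) →
    (∀ m → a (2 * suc m) ≈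
           - (a 0 · half) · ∑ R (suc (2 * m)) (λ k → t (2 * suc m) (suc k) · a (suc k))) →
    (∀ n → 1 ≤ n → ∀ i j → i < n → j < n →
       ∑ R n (λ k → lowerTri R t i k · lowerTri R t k j) ≈ δ R i j)
    × (∑ R 1 (λ k → t 0 k · a k) ≈ 1#)
    × (∑ R 1 (λ k → t 0 k · a (suc k)) ≈ a 0 · a 1)
    × (∑ R 1 (λ k → t 1 (suc k) · a k) ≈ - 1#)
    × (∀ i → 1 ≤ i →
         (∑ R (suc i) (λ k → t i k · a k) ≈ 0#)
       × (∑ R (suc i) (λ k → t i k · a (suc k)) ≈ a 0 · (a i + a (suc i)))
       × (∑ R i (λ k → t i (suc k) · a k) ≈ alt R i))
theorem2 R half half+half≈1 a t a₀-sign t-left t-right t-zero-sum a-even =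
    (λ _ _ _ _ → square≈δ)
  , trans (t-row 0 a) s₀-zero
  , trans (+-identityˡ _) (*-congʳ (t-left 0))
  , s₋₁-formula (s≤s z≤n)
  , λ i 1≤i → trans (t-row i a) (s₀-vanishes 1≤i) , s₁-formula 1≤i , s₋₁-formula 1≤i
  where
  open CommutativeRing R using (trans; +-identityˡ; *-congʳ)
  open ZeroSumTriangle R half half+half≈1 a t a₀-sign t-left t-right t-zero-sum a-even
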